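{- The set of the matrices of the rationals in the interval $(0,1)$ is \[ \left\{\begin{pmatrix} p'&p''\\ q'&q''\end{pmatrix}\in M(2,\mathbb Z)\,:\,1\leq p'\leq q',\ 0\leq p''<q'',\ p'q''-p''q'=1\right\}\subseteq SL(2,\mathbb Z). \]
   Context: Let $\Phi_0=\begin{pmatrix}0&1\\1&1\end{pmatrix}$ and $\Phi_1=\begin{pmatrix}1&0\\1&1\end{pmatrix}$ be the matrices of the two inverse branches $x\mapsto\frac1{1+x}$ and $x\mapsto\frac{x}{1+x}$ of the Farey map $F$ (where $F(x)=\frac{1-x}{x}$ on $[\frac12,1]$, $F(x)=\frac{x}{1-x}$ on $[0,\frac12]$), acting on column vectors $(p,q)^\top$ representing $p/q$. Every rational $\frac pq\in(0,1)$ in lowest terms has a finite binary sequence $\sigma_1\cdots\sigma_\ell$ (with $\sigma_j=0$ if $F^{j-1}(\frac pq)\in(\frac12,1)$, $\sigma_j=1$ if $F^{j-1}(\frac pq)\in(0,\frac12)$, stopping when the image is $\frac12$), and $(p,q)^\top=\prod_{j=1}^{\ell}\Phi_{\sigma_j}\,\Phi_{\sigma_{\ell+1}}(1,1)^\top$ with $\sigma_{\ell+1}\in\{0,1\}$. Of the two matrices $\prod_{j=1}^{\ell}\Phi_{\sigma_j}\cdot\Phi_0$ and $\prod_{j=1}^{\ell}\Phi_{\sigma_j}\cdot\Phi_1$ (which have the same columns in opposite order, with determinants $\pm1$), the one with determinant $+1$ is called the matrix of $\frac pq$. -}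

module Defs where

open import Data.Nat as ℕ using (ℕ; _<_)
open import Data.Integer as ℤ using (ℤ; +_; ∣_∣)
open import Data.Rational as ℚ using (ℚ; ↥_; ↧ₙ_)
open import Data.List using (List; []; _∷_; foldr)
open import Data.Product using (∃-syntax; _×_)
open import Data.Sum using (_⊎_)
open import Relation.Binary.PropositionalEquality using (_≡_)

record Mat : Set where
  constructor mat
  field
    a b c d : ℤ

open Mat public

infixl 7 _·_
_·_ : Mat → Mat → Mat
mat a₁ b₁ c₁ d₁ · mat a₂ b₂ c₂ d₂ =
  mat (a₁ ℤ.* a₂ ℤ.+ b₁ ℤ.* c₂) (a₁ ℤ.* b₂ ℤ.+ b₁ ℤ.* d₂)
      (c₁ ℤ.* a₂ ℤ.+ d₁ ℤ.* c₂) (c₁ ℤ.* b₂ ℤ.+ d₁ ℤ.* d₂)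

det : Mat → ℤ
det (mat a b c d) = a ℤ.* d ℤ.- b ℤ.* c

I₂ : Mat
I₂ = mat (+ 1) (+ 0) (+ 0) (+ 1)

data Bit : Set where
  b0 b1 : Bit

-- Φ₀ = (0 1; 1 1) : x ↦ 1/(1+x),  Φ₁ = (1 0; 1 1) : x ↦ x/(1+x)
Φ : Bit → Mat
Φ b0 = mat (+ 0) (+ 1) (+ 1) (+ 1)
Φ b1 = mat (+ 1) (+ 0) (+ 1) (+ 1)

prodΦ : List Bit → Mat
prodΦ = foldr (λ σ M → Φ σ · M) I₂

-- FareyCode p q σs : the pair p/q (p,q ∈ ℕ, in lowest terms) has Farey
-- sequence σs, computed by iterating F until reaching 1/2:
--   p/q ∈ (1/2,1)  (q < 2p): σ = 0, F(p/q) = (q-p)/p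
--   p/q ∈ (0,1/2)  (2p < q): σ = 1, F(p/q) = p/(q-p)
data FareyCode : ℕ → ℕ → List Bit → Set where
  half  : FareyCode 1 2 []
  step0 : ∀ {p q s} → q < p ℕ.+ p → FareyCode (q ℕ.∸ p) p s → FareyCode p q (b0 ∷ s)
  step1 : ∀ {p q s} → p ℕ.+ p < q → FareyCode p (q ℕ.∸ p) s → FareyCode p q (b1 ∷ s)

IsMatrixOf : ℚ → Mat → Set
IsMatrixOf r M =
  ∃[ s ] (FareyCode ∣ ↥ r ∣ (↧ₙ r) s
         × (M ≡ prodΦ s · Φ b0 ⊎ M ≡ prodΦ s · Φ b1)
         × det M ≡ + 1)

-- Call a matrix (a b; c d) with natural entries reduced if 1 ≤ a ≤ c, b < d and ad − bc = 1.
-- Both M ↦ Φ₁ · M and M ↦ Φ₀ · swapCols M preserve reducedness, and conversely every reduced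
-- matrix other than Φ₁ is the image of a smaller reduced matrix under one of them (which one is
-- decided by comparing c with 2a and d with 2b). Hence every product Φ_{σ₁}⋯Φ_{σℓ}Φ_σ is reduced
-- up to the order of its columns, and the determinant, which changes sign when the columns are
-- swapped, picks the reduced order. Conversely, unwinding a reduced matrix down to Φ₁ writes it
-- as such a product, and σ₁⋯σℓ is the Farey code of (a+b)/(c+d): on the column sum (p, q) the
-- two maps act as (p, q) ↦ (p, p+q) and (p, q) ↦ (q, p+q), the inverse branches of the Farey map,
-- while ad − bc = 1 makes p and q coprime.

module Submission where

open import Defs
open import Data.Integer using (ℤ; +_; _≤_; _<_; _*_; _-_)
open import Data.Rational using (ℚ; 0ℚ; 1ℚ)
open import Data.Product using (∃-syntax; _×_)
open import Function.Bundles using (_⇔_)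
open import Relation.Binary.PropositionalEquality using (_≡_)

open import Data.Empty using (⊥-elim)
open import Data.List using ([]; _∷_)
open import Data.Nat as ℕ using (ℕ; suc; z≤n; s≤s)
open import Data.Nat.Coprimality using (Coprime)
open import Data.Nat.Divisibility using (_∣_; ∣m+n∣m⇒∣n; ∣1⇒≡1; ∣m⇒∣m*n)
open import Data.Nat.Induction using (<-wellFounded)
import Data.Nat.Properties as ℕ
import Data.Nat.Tactic.RingSolver as ℕ-Ring
import Data.Integer as ℤ
import Data.Integer.Properties as ℤ
import Data.Integer.Tactic.RingSolver as ℤ-Ring
open import Data.Rational as ℚ using (mkℚ; *<*)
import Data.Rational.Properties as ℚ
open import Data.Product using (_,_)
open import Data.Sum using (_⊎_; inj₁; inj₂)
open import Function.Bundles using (mk⇔; Equivalence)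
open import Induction.WellFounded using (Acc; acc)
open import Relation.Binary.PropositionalEquality using (_≢_; refl; sym; trans; cong; cong₂; subst; subst₂; module ≡-Reasoning)
open import Relation.Nullary using (yes; no)

mat-cong : ∀ {a a′ b b′ c c′ d d′} → a ≡ a′ → b ≡ b′ → c ≡ c′ → d ≡ d′ →
           mat a b c d ≡ mat a′ b′ c′ d′
mat-cong refl refl refl refl = refl

·-assoc : (A B C : Mat) → (A · B) · C ≡ A · (B · C)
·-assoc (mat a₁ b₁ c₁ d₁) (mat a₂ b₂ c₂ d₂) (mat a₃ b₃ c₃ d₃) =
  mat-cong (entry a₁ b₁ a₂ b₂ c₂ d₂ a₃ c₃) (entry a₁ b₁ a₂ b₂ c₂ d₂ b₃ d₃)
           (entry c₁ d₁ a₂ b₂ c₂ d₂ a₃ c₃) (entry c₁ d₁ a₂ b₂ c₂ d₂ b₃ d₃)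
  where
  entry : ∀ x y p q r t u v →
    (x ℤ.* p ℤ.+ y ℤ.* r) ℤ.* u ℤ.+ (x ℤ.* q ℤ.+ y ℤ.* t) ℤ.* v
      ≡ x ℤ.* (p ℤ.* u ℤ.+ q ℤ.* v) ℤ.+ y ℤ.* (r ℤ.* u ℤ.+ t ℤ.* v)
  entry = ℤ-Ring.solve-∀

swapCols : Mat → Mat
swapCols (mat a b c d) = mat b a d c

·-swapCols : (A B : Mat) → A · swapCols B ≡ swapCols (A · B)
·-swapCols (mat _ _ _ _) (mat _ _ _ _) = refl

det-swapCols : (M : Mat) → det (swapCols M) ≡ ℤ.- det M
det-swapCols (mat a b c d) = antisymmetric a b c d
  where
  antisymmetric : ∀ a b c d → b ℤ.* c ℤ.- a ℤ.* d ≡ ℤ.- (a ℤ.* d ℤ.- b ℤ.* c)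
  antisymmetric = ℤ-Ring.solve-∀

flip : Bit → Bit
flip b0 = b1
flip b1 = b0

·-Φ-flip : (A : Mat) (σ : Bit) → A · Φ (flip σ) ≡ swapCols (A · Φ σ)
·-Φ-flip A b0 = ·-swapCols A (Φ b0)
·-Φ-flip A b1 = ·-swapCols A (Φ b1)

prodΦ-∷-· : ∀ τ s σ → prodΦ (τ ∷ s) · Φ σ ≡ Φ τ · (prodΦ s · Φ σ)
prodΦ-∷-· τ s σ = ·-assoc (Φ τ) (prodΦ s) (Φ σ)

Φ₁-· : ∀ x y z w → Φ b1 · mat x y z w ≡ mat x y (z ℤ.+ x) (w ℤ.+ y)
Φ₁-· x y z w = mat-cong (identity x z) (identity y w) (sum x z) (sum y w)
  where
  identity : ∀ x z → + 1 ℤ.* x ℤ.+ + 0 ℤ.* z ≡ x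
  identity = ℤ-Ring.solve-∀
  sum : ∀ x z → + 1 ℤ.* x ℤ.+ + 1 ℤ.* z ≡ z ℤ.+ x
  sum = ℤ-Ring.solve-∀

Φ₀-· : ∀ x y z w → Φ b0 · mat x y z w ≡ mat z w (x ℤ.+ z) (y ℤ.+ w)
Φ₀-· x y z w = mat-cong (identity x z) (identity y w) (sum x z) (sum y w)
  where
  identity : ∀ x z → + 0 ℤ.* x ℤ.+ + 1 ℤ.* z ≡ z
  identity = ℤ-Ring.solve-∀
  sum : ∀ x z → + 1 ℤ.* x ℤ.+ + 1 ℤ.* z ≡ x ℤ.+ z
  sum = ℤ-Ring.solve-∀

ℕmat : ℕ → ℕ → ℕ → ℕ → Mat
ℕmat a b c d = mat (+ a) (+ b) (+ c) (+ d)

det-ℕmat≡1 : ∀ a b c d → det (ℕmat a b c d) ≡ + 1 ⇔ a ℕ.* d ≡ 1 ℕ.+ b ℕ.* c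
det-ℕmat≡1 a b c d = mk⇔
  (λ det≡1 → ℤ.+-injective (begin
     + (a ℕ.* d)                                ≡⟨ sub-add (+ (a ℕ.* d)) (+ (b ℕ.* c)) ⟩
     + (a ℕ.* d) ℤ.- + (b ℕ.* c) ℤ.+ + (b ℕ.* c) ≡⟨ cong (ℤ._+ + (b ℕ.* c)) (trans (sym det-pos) det≡1) ⟩
     + 1 ℤ.+ + (b ℕ.* c)                        ∎))
  (λ det≡1 → begin
     det (ℕmat a b c d)                          ≡⟨ det-pos ⟩
     + (a ℕ.* d) ℤ.- + (b ℕ.* c)                 ≡⟨ cong (λ n → + n ℤ.- + (b ℕ.* c)) det≡1 ⟩
     + 1 ℤ.+ + (b ℕ.* c) ℤ.- + (b ℕ.* c)         ≡⟨ add-sub (+ (b ℕ.* c)) ⟩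
     + 1                                         ∎)
  where
  open ≡-Reasoning
  det-pos : det (ℕmat a b c d) ≡ + (a ℕ.* d) ℤ.- + (b ℕ.* c)
  det-pos = cong₂ ℤ._-_ (sym (ℤ.pos-* a d)) (sym (ℤ.pos-* b c))
  sub-add : ∀ x y → x ≡ x ℤ.- y ℤ.+ y
  sub-add = ℤ-Ring.solve-∀
  add-sub : ∀ y → + 1 ℤ.+ y ℤ.- y ≡ + 1
  add-sub = ℤ-Ring.solve-∀

record Reduced (a b c d : ℕ) : Set where
  constructor reduced
  field
    1≤a : 1 ℕ.≤ a
    a≤c : a ℕ.≤ c
    b<d : b ℕ.< d
    det≡1 : a ℕ.* d ≡ 1 ℕ.+ b ℕ.* c

ReducedMat : Mat → Set
ReducedMat M = ∃[ a ] ∃[ b ] ∃[ c ] ∃[ d ] (M ≡ ℕmat a b c d × Reduced a b c d)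

Reduced⇒det≡1 : ∀ {a b c d} → Reduced a b c d → det (ℕmat a b c d) ≡ + 1
Reduced⇒det≡1 {a} {b} {c} {d} R = Equivalence.from (det-ℕmat≡1 a b c d) (Reduced.det≡1 R)

ReducedMat⇔conditions : ∀ {p′ p″ q′ q″} → ReducedMat (mat p′ p″ q′ q″) ⇔
  (+ 1 ≤ p′ × p′ ≤ q′ × + 0 ≤ p″ × p″ < q″ × p′ * q″ - p″ * q′ ≡ + 1)
ReducedMat⇔conditions = mk⇔ to from
  where
  to : ∀ {p′ p″ q′ q″} → ReducedMat (mat p′ p″ q′ q″) →
       + 1 ≤ p′ × p′ ≤ q′ × + 0 ≤ p″ × p″ < q″ × p′ * q″ - p″ * q′ ≡ + 1
  to (a , b , c , d , refl , R@(reduced 1≤a a≤c b<d _)) =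
    ℤ.+≤+ 1≤a , ℤ.+≤+ a≤c , ℤ.+≤+ z≤n , ℤ.+<+ b<d , Reduced⇒det≡1 R
  from : ∀ {p′ p″ q′ q″} → + 1 ≤ p′ × p′ ≤ q′ × + 0 ≤ p″ × p″ < q″ × p′ * q″ - p″ * q′ ≡ + 1 →
         ReducedMat (mat p′ p″ q′ q″)
  from (ℤ.+≤+ {n = a} 1≤a , ℤ.+≤+ {n = c} a≤c , ℤ.+≤+ {n = b} _ , ℤ.+<+ {n = d} b<d , det≡1) =
    a , b , c , d , refl , reduced 1≤a a≤c b<d (Equivalence.to (det-ℕmat≡1 a b c d) det≡1)

det≡1⇔Φ₁-det≡1 : ∀ a b c d → a ℕ.* d ≡ 1 ℕ.+ b ℕ.* c ⇔ a ℕ.* (d ℕ.+ b) ≡ 1 ℕ.+ b ℕ.* (c ℕ.+ a)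
det≡1⇔Φ₁-det≡1 a b c d = mk⇔
  (λ eq → trans (left a b d) (trans (cong (ℕ._+ a ℕ.* b) eq) (sym (right a b c))))
  (λ eq → ℕ.+-cancelʳ-≡ (a ℕ.* b) _ _ (trans (sym (left a b d)) (trans eq (right a b c))))
  where
  left : ∀ a b d → a ℕ.* (d ℕ.+ b) ≡ a ℕ.* d ℕ.+ a ℕ.* b
  left = ℕ-Ring.solve-∀
  right : ∀ a b c → 1 ℕ.+ b ℕ.* (c ℕ.+ a) ≡ (1 ℕ.+ b ℕ.* c) ℕ.+ a ℕ.* b
  right = ℕ-Ring.solve-∀

det≡1-transpose : ∀ a b c d → a ℕ.* d ≡ 1 ℕ.+ b ℕ.* c → d ℕ.* a ≡ 1 ℕ.+ c ℕ.* b
det≡1-transpose a b c d eq = trans (ℕ.*-comm d a) (trans eq (cong (1 ℕ.+_) (ℕ.*-comm b c)))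

Reduced-Φ₁ : ∀ {a b c d} → Reduced a b c d → Reduced a b (c ℕ.+ a) (d ℕ.+ b)
Reduced-Φ₁ {a} {b} {c} {d} (reduced 1≤a a≤c b<d det≡1) =
  reduced 1≤a (ℕ.m≤n+m a c) (ℕ.m<n+m b (ℕ.m<n⇒0<n b<d))
          (Equivalence.to (det≡1⇔Φ₁-det≡1 a b c d) det≡1)

Reduced-Φ₀ : ∀ {a b c d} → Reduced a b c d → Reduced d c (b ℕ.+ d) (a ℕ.+ c)
Reduced-Φ₀ {a} {b} {c} {d} (reduced 1≤a a≤c b<d det≡1) =
  reduced (ℕ.m<n⇒0<n b<d) (ℕ.m≤n+m d b) (ℕ.m<n+m c 1≤a)
          (Equivalence.to (det≡1⇔Φ₁-det≡1 d c b a) (det≡1-transpose a b c d det≡1))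

prodΦ-Φ₁ : ∀ s σ {a b c d} → prodΦ s · Φ σ ≡ ℕmat a b c d →
           prodΦ (b1 ∷ s) · Φ σ ≡ ℕmat a b (c ℕ.+ a) (d ℕ.+ b)
prodΦ-Φ₁ s σ {a} {b} {c} {d} eq = begin
  prodΦ (b1 ∷ s) · Φ σ    ≡⟨ prodΦ-∷-· b1 s σ ⟩
  Φ b1 · (prodΦ s · Φ σ)  ≡⟨ cong (Φ b1 ·_) eq ⟩
  Φ b1 · ℕmat a b c d     ≡⟨ Φ₁-· (+ a) (+ b) (+ c) (+ d) ⟩
  ℕmat a b (c ℕ.+ a) (d ℕ.+ b) ∎
  where open ≡-Reasoning

prodΦ-Φ₀ : ∀ s σ {a b c d} → prodΦ s · Φ σ ≡ ℕmat a b c d →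
           prodΦ (b0 ∷ s) · Φ (flip σ) ≡ ℕmat d c (b ℕ.+ d) (a ℕ.+ c)
prodΦ-Φ₀ s σ {a} {b} {c} {d} eq = begin
  prodΦ (b0 ∷ s) · Φ (flip σ)             ≡⟨ prodΦ-∷-· b0 s (flip σ) ⟩
  Φ b0 · (prodΦ s · Φ (flip σ))           ≡⟨ cong (Φ b0 ·_) (·-Φ-flip (prodΦ s) σ) ⟩
  Φ b0 · swapCols (prodΦ s · Φ σ)         ≡⟨ cong (λ M → Φ b0 · swapCols M) eq ⟩
  Φ b0 · swapCols (ℕmat a b c d)          ≡⟨ Φ₀-· (+ b) (+ a) (+ d) (+ c) ⟩
  ℕmat d c (b ℕ.+ d) (a ℕ.+ c)            ∎
  where open ≡-Reasoning

prodΦ-reduced : ∀ s → ∃[ σ ] ReducedMat (prodΦ s · Φ σ)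
prodΦ-reduced [] = b1 , 1 , 0 , 1 , 1 , refl , reduced ℕ.≤-refl ℕ.≤-refl ℕ.0<1+n refl
prodΦ-reduced (b1 ∷ s) with prodΦ-reduced s
... | σ , a , b , c , d , eq , R = σ , a , b , _ , _ , prodΦ-Φ₁ s σ eq , Reduced-Φ₁ R
prodΦ-reduced (b0 ∷ s) with prodΦ-reduced s
... | σ , a , b , c , d , eq , R = flip σ , d , c , _ , _ , prodΦ-Φ₀ s σ eq , Reduced-Φ₀ R

≡∨≡flip : ∀ τ σ → τ ≡ σ ⊎ τ ≡ flip σ
≡∨≡flip b0 b0 = inj₁ refl
≡∨≡flip b0 b1 = inj₂ refl
≡∨≡flip b1 b0 = inj₂ refl
≡∨≡flip b1 b1 = inj₁ refl

unimodular⇒ReducedMat : ∀ s τ → det (prodΦ s · Φ τ) ≡ + 1 → ReducedMat (prodΦ s · Φ τ)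
unimodular⇒ReducedMat s τ det≡1 with prodΦ-reduced s
... | σ , M-reduced@(a , b , c , d , eq , R) with ≡∨≡flip τ σ
... | inj₁ refl = M-reduced
... | inj₂ refl = ⊥-elim (-1≢1 (begin
  ℤ.- + 1                               ≡⟨ cong ℤ.-_ (sym (Reduced⇒det≡1 R)) ⟩
  ℤ.- det (ℕmat a b c d)                ≡⟨ cong (λ M → ℤ.- det M) (sym eq) ⟩
  ℤ.- det (prodΦ s · Φ σ)               ≡⟨ sym (det-swapCols (prodΦ s · Φ σ)) ⟩
  det (swapCols (prodΦ s · Φ σ))        ≡⟨ cong det (sym (·-Φ-flip (prodΦ s) σ)) ⟩
  det (prodΦ s · Φ (flip σ))            ≡⟨ det≡1 ⟩
  + 1                                   ∎))
  where
  open ≡-Reasoning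
  -1≢1 : ℤ.- + 1 ≢ + 1
  -1≢1 ()

matrixOf⇒ReducedMat : ∀ r M → IsMatrixOf r M → ReducedMat M
matrixOf⇒ReducedMat _ _ (s , _ , inj₁ refl , det≡1) = unimodular⇒ReducedMat s b0 det≡1
matrixOf⇒ReducedMat _ _ (s , _ , inj₂ refl , det≡1) = unimodular⇒ReducedMat s b1 det≡1

data Origin : ℕ → ℕ → ℕ → ℕ → Set where
  root : Origin 1 0 1 1
  viaΦ₁ : ∀ {a b c d} → Reduced a b c d → Origin a b (c ℕ.+ a) (d ℕ.+ b)
  viaΦ₀ : ∀ {a b c d} → Reduced a b c d → Origin d c (b ℕ.+ d) (a ℕ.+ c)

m≤n⇒∃[o]o+m≡n : ∀ {m n} → m ℕ.≤ n → ∃[ o ] o ℕ.+ m ≡ n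
m≤n⇒∃[o]o+m≡n {m} m≤n with ℕ.m≤n⇒∃[o]m+o≡n m≤n
... | o , m+o≡n = o , trans (ℕ.+-comm o m) m+o≡n

det≡1∧a≤c⇒b<d : ∀ {a b c d} → a ℕ.* d ≡ 1 ℕ.+ b ℕ.* c → a ℕ.≤ c → b ℕ.< d
det≡1∧a≤c⇒b<d {a} {b} {c} {d} det≡1 a≤c = ℕ.≰⇒> λ d≤b → ℕ.n≮n (b ℕ.* c) (begin-strict
  b ℕ.* c       <⟨ ℕ.n<1+n (b ℕ.* c) ⟩
  1 ℕ.+ b ℕ.* c ≡⟨ sym det≡1 ⟩
  a ℕ.* d       ≤⟨ ℕ.*-mono-≤ a≤c d≤b ⟩
  c ℕ.* b       ≡⟨ ℕ.*-comm c b ⟩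
  b ℕ.* c       ∎)
  where open ℕ.≤-Reasoning

det≡1∧c<a∧b<d⇒root : ∀ {a b c d} → a ℕ.* d ≡ 1 ℕ.+ b ℕ.* c → c ℕ.< a → b ℕ.< d →
                   Origin a b (c ℕ.+ a) (d ℕ.+ b)
det≡1∧c<a∧b<d⇒root {a} {b} {c} {d} det≡1 c<a b<d
  with ℕ.m+n≡0⇒m≡0 b b+c≡0 | ℕ.m+n≡0⇒n≡0 b b+c≡0
  where
  b+c≡0 : b ℕ.+ c ≡ 0
  b+c≡0 = ℕ.n≤0⇒n≡0 (ℕ.+-cancelʳ-≤ (1 ℕ.+ b ℕ.* c) (b ℕ.+ c) 0 (begin
    b ℕ.+ c ℕ.+ (1 ℕ.+ b ℕ.* c) ≡⟨ expand b c ⟩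
    suc b ℕ.* suc c             ≤⟨ ℕ.*-mono-≤ b<d c<a ⟩
    d ℕ.* a                     ≡⟨ ℕ.*-comm d a ⟩
    a ℕ.* d                     ≡⟨ det≡1 ⟩
    1 ℕ.+ b ℕ.* c               ∎))
    where
    open ℕ.≤-Reasoning
    expand : ∀ b c → b ℕ.+ c ℕ.+ (1 ℕ.+ b ℕ.* c) ≡ suc b ℕ.* suc c
    expand = ℕ-Ring.solve-∀
... | refl | refl with ℕ.m*n≡1⇒m≡1 a d det≡1 | ℕ.m*n≡1⇒n≡1 a d det≡1
... | refl | refl = root

origin : ∀ {a b c d} → Reduced a b c d → Origin a b c d
origin {a} {b} (reduced 1≤a a≤c b<d det≡1)
  with m≤n⇒∃[o]o+m≡n a≤c | m≤n⇒∃[o]o+m≡n (ℕ.<⇒≤ b<d)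
... | c′ , refl | d′ , refl =
  split 1≤a (ℕ.+-cancelʳ-< b 0 d′ b<d) (Equivalence.from (det≡1⇔Φ₁-det≡1 a b c′ d′) det≡1)
  where
  split : 1 ℕ.≤ a → 1 ℕ.≤ d′ → a ℕ.* d′ ≡ 1 ℕ.+ b ℕ.* c′ → Origin a b (c′ ℕ.+ a) (d′ ℕ.+ b)
  split 1≤a 1≤d′ det≡1 with a ℕ.≤? c′ | d′ ℕ.≤? b
  ... | yes a≤c′ | _        = viaΦ₁ (reduced 1≤a a≤c′ (det≡1∧a≤c⇒b<d det≡1 a≤c′) det≡1)
  ... | no  a≰c′ | yes d′≤b = viaΦ₀ (reduced 1≤d′ d′≤b (ℕ.≰⇒> a≰c′) (det≡1-transpose a b c′ d′ det≡1))
  ... | no  a≰c′ | no  d′≰b = det≡1∧c<a∧b<d⇒root det≡1 (ℕ.≰⇒> a≰c′) (ℕ.≰⇒> d′≰b)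

Reduced⇒a+b<c+d : ∀ {a b c d} → Reduced a b c d → a ℕ.+ b ℕ.< c ℕ.+ d
Reduced⇒a+b<c+d (reduced _ a≤c b<d _) = ℕ.+-mono-≤-< a≤c b<d

FareyCode-step₁ : ∀ {p r s} → p ℕ.< r → FareyCode p r s → FareyCode p (p ℕ.+ r) (b1 ∷ s)
FareyCode-step₁ {p} {r} {s} p<r code =
  step1 (ℕ.+-monoʳ-< p p<r) (subst (λ q → FareyCode p q s) (sym (ℕ.m+n∸m≡n p r)) code)

FareyCode-step₀ : ∀ {p r s} → p ℕ.< r → FareyCode p r s → FareyCode r (p ℕ.+ r) (b0 ∷ s)
FareyCode-step₀ {p} {r} {s} p<r code =
  step0 (ℕ.+-monoˡ-< r p<r) (subst (λ q → FareyCode q r s) (sym (ℕ.m+n∸n≡m p r)) code)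

sum-Φ₁ : ∀ a b c d → (a ℕ.+ b) ℕ.+ (c ℕ.+ d) ≡ (c ℕ.+ a) ℕ.+ (d ℕ.+ b)
sum-Φ₁ = ℕ-Ring.solve-∀

sum-Φ₀ : ∀ a b c d → (a ℕ.+ b) ℕ.+ (d ℕ.+ c) ≡ (b ℕ.+ d) ℕ.+ (a ℕ.+ c)
sum-Φ₀ = ℕ-Ring.solve-∀

Reduced⇒0<a+b : ∀ {a b c d} → Reduced a b c d → 0 ℕ.< a ℕ.+ b
Reduced⇒0<a+b {a} {b} R = ℕ.<-≤-trans (Reduced.1≤a R) (ℕ.m≤m+n a b)

FareyCode-Φ₁ : ∀ {a b c d s} → Reduced a b c d → FareyCode (a ℕ.+ b) (c ℕ.+ d) s →
               FareyCode (a ℕ.+ b) ((c ℕ.+ a) ℕ.+ (d ℕ.+ b)) (b1 ∷ s)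
FareyCode-Φ₁ {a} {b} {c} {d} {s} R code =
  subst (λ q → FareyCode (a ℕ.+ b) q (b1 ∷ s)) (sum-Φ₁ a b c d)
        (FareyCode-step₁ (Reduced⇒a+b<c+d R) code)

FareyCode-Φ₀ : ∀ {a b c d s} → Reduced a b c d → FareyCode (a ℕ.+ b) (c ℕ.+ d) s →
               FareyCode (d ℕ.+ c) ((b ℕ.+ d) ℕ.+ (a ℕ.+ c)) (b0 ∷ s)
FareyCode-Φ₀ {a} {b} {c} {d} {s} R code =
  subst (λ q → FareyCode (d ℕ.+ c) q (b0 ∷ s)) (sum-Φ₀ a b c d)
        (FareyCode-step₀ (subst (a ℕ.+ b ℕ.<_) c+d≡d+c (Reduced⇒a+b<c+d R))
                         (subst (λ q → FareyCode (a ℕ.+ b) q s) c+d≡d+c code))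
  where
  c+d≡d+c : c ℕ.+ d ≡ d ℕ.+ c
  c+d≡d+c = ℕ.+-comm c d

fareyFactorization : ∀ {a b c d} → Reduced a b c d → Acc ℕ._<_ (c ℕ.+ d) →
  ∃[ s ] (FareyCode (a ℕ.+ b) (c ℕ.+ d) s × ∃[ σ ] prodΦ s · Φ σ ≡ ℕmat a b c d)
fareyFactorization R (acc rec) with origin R
... | root = [] , half , b1 , refl
... | viaΦ₁ {a} {b} {c} {d} R′ with fareyFactorization R′ (rec smaller)
  where
  smaller : c ℕ.+ d ℕ.< (c ℕ.+ a) ℕ.+ (d ℕ.+ b)
  smaller = subst (c ℕ.+ d ℕ.<_) (sum-Φ₁ a b c d) (ℕ.m<n+m (c ℕ.+ d) (Reduced⇒0<a+b R′))
... | s , code , σ , eq = b1 ∷ s , FareyCode-Φ₁ R′ code , σ , prodΦ-Φ₁ s σ eq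
fareyFactorization R (acc rec) | viaΦ₀ {a} {b} {c} {d} R′ with fareyFactorization R′ (rec smaller)
  where
  smaller : c ℕ.+ d ℕ.< (b ℕ.+ d) ℕ.+ (a ℕ.+ c)
  smaller = subst₂ ℕ._<_ (ℕ.+-comm d c) (sum-Φ₀ a b c d) (ℕ.m<n+m (d ℕ.+ c) (Reduced⇒0<a+b R′))
... | s , code , σ , eq = b0 ∷ s , FareyCode-Φ₀ R′ code , flip σ , prodΦ-Φ₀ s σ eq

Bézout⇒coprime : ∀ {m n} x y → n ℕ.* y ≡ m ℕ.* x ℕ.+ 1 → Coprime m n
Bézout⇒coprime {m} {n} x y eq {k} (k∣m , k∣n) =
  ∣1⇒≡1 (∣m+n∣m⇒∣n (subst (k ∣_) eq (∣m⇒∣m*n y k∣n)) (∣m⇒∣m*n x k∣m))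

Reduced⇒coprime : ∀ {a b c d} → Reduced a b c d → Coprime (a ℕ.+ b) (c ℕ.+ d)
Reduced⇒coprime {a} {b} {c} {d} R = Bézout⇒coprime c a (begin
  (c ℕ.+ d) ℕ.* a             ≡⟨ left a c d ⟩
  c ℕ.* a ℕ.+ a ℕ.* d         ≡⟨ cong (c ℕ.* a ℕ.+_) (Reduced.det≡1 R) ⟩
  c ℕ.* a ℕ.+ (1 ℕ.+ b ℕ.* c) ≡⟨ right a b c ⟩
  (a ℕ.+ b) ℕ.* c ℕ.+ 1       ∎)
  where
  open ≡-Reasoning
  left : ∀ a c d → (c ℕ.+ d) ℕ.* a ≡ c ℕ.* a ℕ.+ a ℕ.* d
  left = ℕ-Ring.solve-∀
  right : ∀ a b c → c ℕ.* a ℕ.+ (1 ℕ.+ b ℕ.* c) ≡ (a ℕ.+ b) ℕ.* c ℕ.+ 1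
  right = ℕ-Ring.solve-∀

ReducedMat⇒matrixOf : ∀ {M} → ReducedMat M → ∃[ r ] (0ℚ ℚ.< r × r ℚ.< 1ℚ × IsMatrixOf r M)
-- Matching on 1 ≤ a ≤ c exposes c = suc _, so ↧ₙ r computes to c + d on the nose.
ReducedMat⇒matrixOf (a , b , c , d , refl , R@(reduced (s≤s z≤n) (s≤s _) _ _))
  with fareyFactorization R (<-wellFounded (c ℕ.+ d))
... | s , code , σ , eq =
  r , ℚ.positive⁻¹ r , r<1 , s , code , either σ (sym eq) , Reduced⇒det≡1 R
  where
  r : ℚ
  r = mkℚ (+ (a ℕ.+ b)) (ℕ.pred (c ℕ.+ d)) (Reduced⇒coprime R)
  r<1 : r ℚ.< 1ℚ
  r<1 = *<* (subst₂ ℤ._<_ (sym (ℤ.*-identityʳ _)) (sym (ℤ.*-identityˡ _)) (ℤ.+<+ (Reduced⇒a+b<c+d R)))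
  either : ∀ σ → ℕmat a b c d ≡ prodΦ s · Φ σ → ℕmat a b c d ≡ prodΦ s · Φ b0 ⊎ ℕmat a b c d ≡ prodΦ s · Φ b1
  either b0 = inj₁
  either b1 = inj₂

lemma3p4 : (p′ p″ q′ q″ : ℤ) →
    (∃[ r ] (0ℚ Data.Rational.< r × r Data.Rational.< 1ℚ × IsMatrixOf r (mat p′ p″ q′ q″)))
    ⇔ (+ 1 ≤ p′ × p′ ≤ q′ × + 0 ≤ p″ × p″ < q″ × p′ * q″ - p″ * q′ ≡ + 1)
lemma3p4 p′ p″ q′ q″ = mk⇔
  (λ (r , _ , _ , isMatrixOf) →
     Equivalence.to ReducedMat⇔conditions (matrixOf⇒ReducedMat r (mat p′ p″ q′ q″) isMatrixOf))
  (λ rhs → ReducedMat⇒matrixOf (Equivalence.from ReducedMat⇔conditions rhs))
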